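{- Let $H$ be a square-free graph and $W=\gamma_0\gamma_1\cdots\gamma_k$, $k\ge1$, an nc-walk in $H$, and let $\mathcal K$ be the edge gadget of $W$. Then: (1) for every $\theta\in N_H(\gamma_0)\setminus\{\gamma_1\}$ and every $\sigma\in\mathsf{Hom}((\mathcal K,s),(H,\theta))$, $\sigma(v_i)=\gamma_{i-1}$ for all $i\in\{1,\dots,k-1\}$; (2) for every $\theta\in N_H(\gamma_k)\setminus\{\gamma_{k-1}\}$ and every $\sigma\in\mathsf{Hom}((\mathcal K,t),(H,\theta))$, $\sigma(v_i)=\gamma_{i+1}$ for all $i\in\{1,\dots,k-1\}$.
   Context: Graphs are finite, undirected, loopless, without parallel edges; square-free means no cycle of length 4; $N_H(v)$ is the neighbourhood of $v$. An nc-walk is a walk $\gamma_0\gamma_1\cdots\gamma_k$ with $\gamma_{i-1}\ne\gamma_{i+1}$ for all $i\in\{1,\dots,k-1\}$. A partial $H$-labelled graph is a graph with a partial pinning function to $V(H)$; its homomorphisms to $H$ are graph homomorphisms extending the pinning. $\mathsf{Hom}((\mathcal G,x_1,\dots,x_r),(H,y_1,\dots,y_r))$ is the set of such homomorphisms additionally mapping $x_i$ to $y_i$. The edge gadget $\mathcal K=(K,\tau)$ of $W$: $K$ consists of a path $s\,v_1\,v_2\cdots v_{k-1}\,t$ (the single edge $st$ when $k=1$) together with vertices $u_1,\dots,u_{k-1}$ and edges $v_iu_i$; the pinning is $\tau(u_i)=\gamma_i$ for $i\in\{1,\dots,k-1\}$. -}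

module Defs where

open import Data.Nat using (ℕ; suc)
open import Data.Fin using (Fin; zero; suc; inject₁; fromℕ)
open import Data.Sum using (_⊎_; inj₁; inj₂)
open import Data.Empty using (⊥)
open import Relation.Binary.PropositionalEquality using (_≡_; _≢_)

record Graph : Set₁ where
  field
    n     : ℕ
    Adj   : Fin n → Fin n → Set
    sym   : ∀ {x y} → Adj x y → Adj y x
    irrefl : ∀ {x} → Adj x x → ⊥
  V : Set
  V = Fin n

open Graph public

SquareFree : Graph → Set
SquareFree H = ∀ (a b c d : V H) → Adj H a b → Adj H b c → Adj H c d → Adj H d a →
               a ≢ c → b ≢ d → ⊥

IsWalk : (H : Graph) (k : ℕ) → (Fin (suc k) → V H) → Set
IsWalk H k γ = ∀ (i : Fin k) → Adj H (γ (inject₁ i)) (γ (suc i))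

-- nc-walk with k = suc m: γ_{i-1} ≠ γ_{i+1} for i ∈ {1,…,k-1}
-- (index j : Fin m stands for i = j+1).
IsNCWalk : (H : Graph) (m : ℕ) → (Fin (suc (suc m)) → V H) → Set
IsNCWalk H m γ = IsWalk H (suc m) γ ×' (∀ (j : Fin m) → γ (inject₁ (inject₁ j)) ≢ γ (suc (suc j)))
  where
  open import Data.Product using () renaming (_×_ to _×'_)

-- Vertices: path positions p : Fin (suc k)  (position 0 = s, position k = t,
-- position i = v_i for 1 ≤ i ≤ k-1), and pendant vertices u_i, indexed by
-- j : Fin m standing for i = j+1.
GadgetV : ℕ → Set
GadgetV m = Fin (suc (suc m)) ⊎ Fin m

gs : ∀ {m} → GadgetV m
gs = inj₁ zero

gt : ∀ {m} → GadgetV m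
gt {m} = inj₁ (fromℕ (suc m))

gv : ∀ {m} → Fin m → GadgetV m
gv j = inj₁ (suc (inject₁ j))

gu : ∀ {m} → Fin m → GadgetV m
gu j = inj₂ j

data GadgetEdge (m : ℕ) : GadgetV m → GadgetV m → Set where
  path    : (i : Fin (suc m)) → GadgetEdge m (inj₁ (inject₁ i)) (inj₁ (suc i))
  pendant : (j : Fin m) → GadgetEdge m (gv j) (gu j)

-- Homomorphisms of the partial H-labelled edge gadget of γ to H
-- (graph homomorphisms respecting the pinning τ(u_i) = γ_i).
IsGadgetHom : (H : Graph) (m : ℕ) (γ : Fin (suc (suc m)) → V H) → (GadgetV m → V H) → Set
IsGadgetHom H m γ σ =
  (∀ x y → GadgetEdge m x y → Adj H (σ x) (σ y)) ×'
  (∀ (j : Fin m) → σ (gu j) ≡ γ (suc (inject₁ j)))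
  where
  open import Data.Product using () renaming (_×_ to _×'_)

-- In a square-free graph two distinct vertices have at most one common neighbour.
-- Walking along the gadget from the pinned end, each σ(vᵢ) is adjacent to the image
-- of its predecessor and to the pinned σ(uᵢ) = γᵢ; the walk vertex γᵢ₋₁ (resp. γᵢ₊₁)
-- is another common neighbour of these two vertices, which are distinct because the
-- walk is non-backtracking (resp. by the choice of θ), so the two must coincide.
module Submission where

open import Defs
open import Data.Nat using (ℕ; suc)
open import Data.Fin using (Fin; zero; suc; inject₁; fromℕ; _≟_)
open import Data.Fin.Induction using (<-weakInduction; >-weakInduction)
open import Data.Product using (_×_; _,_)
open import Relation.Nullary using (yes; no)
open import Data.Empty using (⊥-elim)
open import Relation.Binary.PropositionalEquality using (_≡_; _≢_; ≢-sym; subst)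

module _ (H : Graph) (square-free : SquareFree H) where

  common-neighbour-unique : ∀ {a b c d} → Adj H a b → Adj H b c → Adj H a d → Adj H d c →
                            a ≢ c → b ≡ d
  common-neighbour-unique {a} {b} {c} {d} ab bc ad dc a≢c with b ≟ d
  ... | yes b≡d = b≡d
  ... | no b≢d = ⊥-elim (square-free a b c d ab bc (sym H dc) (sym H ad) a≢c b≢d)

  adj-cong : ∀ {x x′ y} → x ≡ x′ → Adj H x y → Adj H x′ y
  adj-cong {y = y} = subst (λ x → Adj H x y)

  pendant-adj : ∀ {m γ σ} → IsGadgetHom H m γ σ → ∀ j → Adj H (σ (gv j)) (γ (suc (inject₁ j)))
  pendant-adj {σ = σ} (edge , pinned) j = subst (Adj H (σ (gv j))) (pinned j) (edge _ _ (pendant j))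

  gadgetHom-from-s : ∀ {m γ σ} → IsNCWalk H m γ → IsGadgetHom H m γ σ →
                     ∀ θ → Adj H (γ zero) θ → θ ≢ γ (suc zero) → σ gs ≡ θ →
                     ∀ j → σ (gv j) ≡ γ (inject₁ (inject₁ j))
  gadgetHom-from-s {0} _ _ _ _ _ _ ()
  gadgetHom-from-s {suc _} {γ} {σ} (walk , non-backtracking) hom@(edge , _) θ γ₀θ θ≢γ₁ σs≡θ =
    <-weakInduction (λ j → σ (gv j) ≡ γ (inject₁ (inject₁ j))) first next
    where
    σv~γ : ∀ j → Adj H (σ (gv j)) (γ (suc (inject₁ j)))
    σv~γ = pendant-adj {γ = γ} hom

    first : σ (gv zero) ≡ γ zero
    first = common-neighbour-unique (adj-cong σs≡θ (edge _ _ (path zero))) (σv~γ zero)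
              (sym H γ₀θ) (walk zero) θ≢γ₁

    next : ∀ i → σ (gv (inject₁ i)) ≡ γ (inject₁ (inject₁ (inject₁ i))) →
           σ (gv (suc i)) ≡ γ (suc (inject₁ (inject₁ i)))
    next i σv≡γ = common-neighbour-unique
      (adj-cong σv≡γ (edge _ _ (path (suc (inject₁ i))))) (σv~γ (suc i))
      (walk (inject₁ (inject₁ i))) (walk (suc (inject₁ i)))
      (non-backtracking (inject₁ i))

  gadgetHom-from-t : ∀ {m γ σ} → IsNCWalk H m γ → IsGadgetHom H m γ σ →
                     ∀ θ → Adj H (γ (fromℕ (suc m))) θ → θ ≢ γ (inject₁ (fromℕ m)) → σ gt ≡ θ →
                     ∀ j → σ (gv j) ≡ γ (suc (suc j))
  gadgetHom-from-t {0} _ _ _ _ _ _ ()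
  gadgetHom-from-t {suc m} {γ} {σ} (walk , non-backtracking) hom@(edge , _) θ γₖθ θ≢γₖ₋₁ σt≡θ =
    >-weakInduction (λ j → σ (gv j) ≡ γ (suc (suc j))) last previous
    where
    σv~γ : ∀ j → Adj H (σ (gv j)) (γ (suc (inject₁ j)))
    σv~γ = pendant-adj {γ = γ} hom

    last : σ (gv (fromℕ m)) ≡ γ (fromℕ (suc (suc m)))
    last = common-neighbour-unique
      (adj-cong σt≡θ (sym H (edge _ _ (path (fromℕ (suc m)))))) (σv~γ (fromℕ m))
      (sym H γₖθ) (sym H (walk (fromℕ (suc m)))) θ≢γₖ₋₁

    previous : ∀ i → σ (gv (suc i)) ≡ γ (suc (suc (suc i))) →
               σ (gv (inject₁ i)) ≡ γ (suc (suc (inject₁ i)))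
    previous i σv≡γ = common-neighbour-unique
      (adj-cong σv≡γ (sym H (edge _ _ (path (suc (inject₁ i)))))) (σv~γ (inject₁ i))
      (sym H (walk (suc (suc i)))) (sym H (walk (suc (inject₁ i))))
      (≢-sym (non-backtracking (suc i)))

lemma3 : (H : Graph) → SquareFree H → (m : ℕ) → (γ : Fin (suc (suc m)) → V H) →
         IsNCWalk H m γ →
         ((θ : V H) → Adj H (γ zero) θ → θ ≢ γ (suc zero) →
           (σ : GadgetV m → V H) → IsGadgetHom H m γ σ → σ gs ≡ θ →
           ∀ (j : Fin m) → σ (gv j) ≡ γ (inject₁ (inject₁ j)))
         ×
         ((θ : V H) → Adj H (γ (fromℕ (suc m))) θ → θ ≢ γ (inject₁ (fromℕ m)) →
           (σ : GadgetV m → V H) → IsGadgetHom H m γ σ → σ gt ≡ θ →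
           ∀ (j : Fin m) → σ (gv j) ≡ γ (suc (suc j)))
lemma3 H square-free m γ ncWalk =
  (λ θ γ₀θ θ≢γ₁ σ hom → gadgetHom-from-s H square-free {m} {γ} {σ} ncWalk hom θ γ₀θ θ≢γ₁)
  , (λ θ γₖθ θ≢γₖ₋₁ σ hom → gadgetHom-from-t H square-free {m} {γ} {σ} ncWalk hom θ γₖθ θ≢γₖ₋₁)
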